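{- Let $G$ be a connected graph with $n$ vertices and $m$ edges. Then $tmc(G)=m+n-2$ if and only if $G=K_n-K_2$.
   Context: All graphs are simple, finite and undirected. A graph is total-colored if all its edges and all its vertices are assigned colors. A path in a total-colored graph is a total monochromatic path if all its edges and all its internal vertices have the same color. A total-coloring is a TMC-coloring if any two vertices are connected by a total monochromatic path. For a connected graph $G$, $tmc(G)$ is the maximum number of colors used in a TMC-coloring of $G$. For a graph $H$, $K_n-H$ denotes the graph obtained from the complete graph $K_n$ by deleting the edges of a copy of $H$ in $K_n$; thus $K_n-K_2$ is $K_n$ with one edge removed. -}

module Defs where

open import Data.Nat using (ℕ; _≤_; _+_; _<ᵇ_; _≟_)
open import Data.Fin using (Fin; toℕ)
open import Data.Bool using (Bool; true; false; _∧_)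
open import Data.List using (List; []; _∷_; _++_; map; length; filterᵇ; cartesianProduct; allFin; deduplicate)
open import Data.List.Relation.Unary.All using (All)
open import Data.List.Relation.Unary.Unique.Propositional using (Unique)
open import Data.Product using (Σ; _×_; _,_; ∃)
open import Data.Unit using (⊤)
open import Relation.Binary.PropositionalEquality using (_≡_; _≢_)

record Graph (n : ℕ) : Set where
  field
    adj    : Fin n → Fin n → Bool
    sym    : ∀ i j → adj i j ≡ adj j i
    irrefl : ∀ i → adj i i ≡ false
open Graph public

edgeList : ∀ {n} → Graph n → List (Fin n × Fin n)
edgeList {n} G =
  filterᵇ (λ { (i , j) → (toℕ i <ᵇ toℕ j) ∧ adj G i j })
          (cartesianProduct (allFin n) (allFin n))

numEdges : ∀ {n} → Graph n → ℕ
numEdges G = length (edgeList G)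

KnMinusK2 : ∀ {n} → Fin n → Fin n → Fin n → Fin n → Set
KnMinusK2 a b i j = (i ≢ j) × ((i , j) ≢ (a , b)) × ((i , j) ≢ (b , a))

IsKnMinusK2 : ∀ {n} → Graph n → Set
IsKnMinusK2 {n} G =
  Σ (Fin n) λ a → Σ (Fin n) λ b → (a ≢ b) ×
    (∀ i j → (adj G i j ≡ true → KnMinusK2 a b i j) × (KnMinusK2 a b i j → adj G i j ≡ true))

-- Total colouring with colours in ℕ: a colour for each vertex and for each edge.
-- Edge colours are given by a symmetric function; only its values on edges matter.
record TotalColoring (n : ℕ) : Set where
  field
    vc     : Fin n → ℕ
    ec     : Fin n → Fin n → ℕ
    ec-sym : ∀ i j → ec i j ≡ ec j i
open TotalColoring public

colorsUsed : ∀ {n} → (G : Graph n) → TotalColoring n → ℕ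
colorsUsed {n} G c =
  length (deduplicate _≟_ (map (vc c) (allFin n) ++ map (λ { (i , j) → ec c i j }) (edgeList G)))

Chain : ∀ {n} → (Fin n → Fin n → Set) → List (Fin n) → Set
Chain R []            = ⊤
Chain R (x ∷ [])      = ⊤
Chain R (x ∷ y ∷ xs)  = R x y × Chain R (y ∷ xs)

IsPath : ∀ {n} → Graph n → Fin n → Fin n → List (Fin n) → Set
IsPath G u v ws =
  Unique (u ∷ ws ++ v ∷ []) × Chain (λ x y → adj G x y ≡ true) (u ∷ ws ++ v ∷ [])

Connected : ∀ {n} → Graph n → Set
Connected {n} G = ∀ (u v : Fin n) → u ≢ v → ∃ λ ws → IsPath G u v ws

IsTMPath : ∀ {n} → Graph n → TotalColoring n → Fin n → Fin n → List (Fin n) → Set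
IsTMPath G c u v ws =
  IsPath G u v ws × Σ ℕ λ col →
    All (λ w → vc c w ≡ col) ws × Chain (λ x y → ec c x y ≡ col) (u ∷ ws ++ v ∷ [])

IsTMCColoring : ∀ {n} → Graph n → TotalColoring n → Set
IsTMCColoring {n} G c = ∀ (u v : Fin n) → u ≢ v → ∃ λ ws → IsTMPath G c u v ws

TmcIs : ∀ {n} → Graph n → ℕ → Set
TmcIs {n} G k =
  (Σ (TotalColoring n) λ c → IsTMCColoring G c × colorsUsed G c ≡ k)
  × (∀ (c : TotalColoring n) → IsTMCColoring G c → colorsUsed G c ≤ k)

module Submission where

-- Count colours over the n + m items (vertices and edges) of G. For a non-adjacent pair u, v a total
-- monochromatic u–v path starts with a monochromatic cherry u–w–y: the edge uw, the vertex w and the edge wy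
-- share one colour, so at most n + m − 2 colours occur. Two different non-edges put a fourth item into the colour
-- class of such a cherry (the next vertex of a longer path, a second centre, or an edge from the centre to a
-- vertex outside the first pair), or else give two cherries of different colours; either way at most n + m − 3
-- colours occur. A complete graph has a rainbow TMC-colouring with n + m colours, so tmc = n + m − 2 forces
-- exactly one non-edge ab. Conversely, in K_n − ab colour all items differently and then give the centre w of a
-- path a–w–b and the edge wb the colour of aw: this is a TMC-colouring with n + m − 2 colours.

open import Defs hiding (sym)
open import Data.Nat using (ℕ; suc; _+_; _≤_; _<_; _<?_; z≤n; s≤s⁻¹)
import Data.Nat as ℕ
open import Data.Nat.Properties
  using (<-cmp; <-asym; <ᵇ⇒<; <⇒<ᵇ; ≤⇒≯; m≤m+n; n≤1+n; 1+n≰n; ≤-antisym; ≤-trans;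
         +-mono-≤; +-monoʳ-≤; +-cancelˡ-≤; +-cancelˡ-≡; +-suc; +-comm; +-commutativeSemigroup;
         module ≤-Reasoning)
open import Algebra.Properties.CommutativeSemigroup +-commutativeSemigroup using (x∙yz≈y∙xz)
open import Data.Fin using (Fin; toℕ; combine)
import Data.Fin as Fin
open import Data.Fin.Properties using (toℕ-injective; toℕ<n; combine-injective; any?)
open import Data.Bool using (true; false; if_then_else_)
open import Data.Bool.Properties using (T-∧; T-≡)
import Data.Bool as Bool
open import Data.List using (List; []; _∷_; _++_; map; length; filter; deduplicate; allFin; cartesianProduct)
open import Data.List.Properties using (length-++; length-map; length-tabulate; map-++; map-∘; filter-notAll)
open import Data.List.Membership.Propositional using (_∈_; _∉_)
open import Data.List.Membership.Propositional.Properties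
  using (∈-allFin; ∈-map⁺; ∈-map⁻; ∈-filter⁺; ∈-filter⁻; ∈-++⁺ˡ; ∈-++⁺ʳ; ∈-++⁻;
         ∈-cartesianProduct⁺; ∈-deduplicate⁺; ∈-deduplicate⁻)
open import Data.List.Relation.Binary.Subset.Propositional using (_⊆_)
open import Data.List.Relation.Binary.Subset.Propositional.Properties
  using (filter-⊆) renaming (map⁺ to ⊆-map⁺)
open import Data.List.Relation.Unary.All as All using (All; []; _∷_)
open import Data.List.Relation.Unary.All.Properties using (map⁺)
open import Data.List.Relation.Unary.Any as Any using (here; there)
open import Data.List.Relation.Unary.AllPairs using ([]; _∷_)
open import Data.List.Relation.Unary.Unique.Propositional using (Unique)
open import Data.List.Relation.Unary.Unique.Propositional.Properties
  using (filter⁺; allFin⁺; cartesianProduct⁺) renaming (++⁺ to Unique-++⁺; map⁺ to Unique-map⁺)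
open import Data.List.Relation.Unary.Unique.DecPropositional.Properties ℕ._≟_ using (deduplicate-!)
open import Data.Product using (_×_; _,_; proj₁; proj₂; ∃; ∃₂; uncurry)
open import Data.Product.Properties using (×-≡,≡→≡) renaming (≡-dec to ×-≡-dec)
open import Data.Sum using (_⊎_; inj₁; inj₂)
open import Data.Sum.Properties using (inj₁-injective; inj₂-injective) renaming (≡-dec to ⊎-≡-dec)
open import Data.Unit using (tt)
open import Data.Empty using (⊥-elim)
open import Function using (_∘_; Equivalence)
open import Relation.Nullary using (¬_; yes; no; ¬?; does)
open import Relation.Nullary.Decidable using (_×-dec_; dec-true; dec-false)
open import Relation.Unary using (Pred; Decidable)
open import Relation.Unary.Properties using (∁?)
open import Relation.Binary.Definitions using (DecidableEquality; tri<; tri≈; tri>)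
open import Relation.Binary.PropositionalEquality
  using (_≡_; _≢_; refl; sym; trans; cong; cong₂; subst; subst₂; module ≡-Reasoning)

-- Counting distinct colours of a list

length-filter-∁ : ∀ {p} {A : Set} {P : Pred A p} (P? : Decidable P) xs →
                  length (filter P? xs) + length (filter (∁? P?) xs) ≡ length xs
length-filter-∁ P? [] = refl
length-filter-∁ P? (x ∷ xs) with P? x
... | yes _ = cong suc (length-filter-∁ P? xs)
... | no  _ = trans (+-suc _ _) (cong suc (length-filter-∁ P? xs))

Unique⇒length-≤ : ∀ {A : Set} → DecidableEquality A → {xs ys : List A} →
                  Unique xs → xs ⊆ ys → length xs ≤ length ys
Unique⇒length-≤ _≟_ {[]}     _            _     = z≤n
Unique⇒length-≤ _≟_ {x ∷ xs} {ys} (x∉xs ∷ !xs) xs⊆ys = begin-strict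
  length xs              ≤⟨ Unique⇒length-≤ _≟_ !xs xs⊆ys-x ⟩
  length (filter ≢x? ys) <⟨ filter-notAll ≢x? ys (Any.map (λ x≡y y≢x → y≢x (sym x≡y)) x∈ys) ⟩
  length ys              ∎
  where
  open ≤-Reasoning
  ≢x? : Decidable (_≢ x)
  ≢x? = ¬? ∘ (_≟ x)
  x∈ys : x ∈ ys
  x∈ys = xs⊆ys (here refl)
  xs⊆ys-x : xs ⊆ filter ≢x? ys
  xs⊆ys-x z∈xs = ∈-filter⁺ ≢x? (xs⊆ys (there z∈xs)) (All.lookup x∉xs z∈xs ∘ sym)

map⁺-injectiveOn : ∀ {A B : Set} {f : A → B} {xs} →
                   (∀ {x y} → x ∈ xs → y ∈ xs → f x ≡ f y → x ≡ y) → Unique xs → Unique (map f xs)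
map⁺-injectiveOn {xs = []}     inj []            = []
map⁺-injectiveOn {xs = x ∷ xs} inj (x∉xs ∷ !xs) =
  map⁺ (All.tabulate λ y∈xs fx≡fy → All.lookup x∉xs y∈xs (inj (here refl) (there y∈xs) fx≡fy))
  ∷ map⁺-injectiveOn (λ p q → inj (there p) (there q)) !xs

#colours : ∀ {A : Set} → (A → ℕ) → List A → ℕ
#colours f xs = length (deduplicate ℕ._≟_ (map f xs))

module ColourCounting {A : Set} (_≟_ : DecidableEquality A) where

  open import Data.List.Membership.DecPropositional _≟_ using (_∈?_; _∉?_)

  _∩_ _∖_ : List A → List A → List A
  xs ∩ S = filter (_∈? S) xs
  xs ∖ S = filter (_∉? S) xs

  length-∩+∖ : ∀ xs S → length (xs ∩ S) + length (xs ∖ S) ≡ length xs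
  length-∩+∖ xs S = length-filter-∁ (_∈? S) xs

  #colours-≤ : ∀ {f xs S cs} → Unique S → S ⊆ xs → All (λ s → f s ∈ cs) S →
               length S + #colours f xs ≤ length cs + length xs
  #colours-≤ {f} {xs} {S} {cs} !S S⊆xs fS⊆cs = begin
    length S + #colours f xs                         ≤⟨ +-mono-≤ S≤xs∩S colours≤ ⟩
    length (xs ∩ S) + (length cs + length (xs ∖ S))  ≡⟨ x∙yz≈y∙xz (length (xs ∩ S)) (length cs) _ ⟩
    length cs + (length (xs ∩ S) + length (xs ∖ S))  ≡⟨ cong (length cs +_) (length-∩+∖ xs S) ⟩
    length cs + length xs                            ∎
    where
    open ≤-Reasoning
    S≤xs∩S : length S ≤ length (xs ∩ S)
    S≤xs∩S = Unique⇒length-≤ _≟_ !S λ s∈S → ∈-filter⁺ (_∈? S) (S⊆xs s∈S) s∈S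
    colours⊆ : deduplicate ℕ._≟_ (map f xs) ⊆ cs ++ map f (xs ∖ S)
    colours⊆ k∈ with ∈-map⁻ f (∈-deduplicate⁻ ℕ._≟_ (map f xs) k∈)
    ... | x , x∈xs , refl with x ∈? S
    ...   | yes x∈S = ∈-++⁺ˡ (All.lookup fS⊆cs x∈S)
    ...   | no  x∉S = ∈-++⁺ʳ cs (∈-map⁺ f (∈-filter⁺ (_∉? S) x∈xs x∉S))
    colours≤ : #colours f xs ≤ length cs + length (xs ∖ S)
    colours≤ = begin
      #colours f xs                        ≤⟨ Unique⇒length-≤ ℕ._≟_ (deduplicate-! _) colours⊆ ⟩
      length (cs ++ map f (xs ∖ S))        ≡⟨ length-++ cs ⟩
      length cs + length (map f (xs ∖ S))  ≡⟨ cong (length cs +_) (length-map f (xs ∖ S)) ⟩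
      length cs + length (xs ∖ S)          ∎

  ≤-#colours : ∀ {f xs} S → Unique xs →
               (∀ {x y} → x ∈ xs ∖ S → y ∈ xs ∖ S → f x ≡ f y → x ≡ y) →
               length xs ≤ length S + #colours f xs
  ≤-#colours {f} {xs} S !xs inj = begin
    length xs                                  ≡⟨ length-∩+∖ xs S ⟨
    length (xs ∩ S) + length (xs ∖ S)          ≡⟨ cong (length (xs ∩ S) +_) (length-map f (xs ∖ S)) ⟨
    length (xs ∩ S) + length (map f (xs ∖ S))  ≤⟨ +-mono-≤ xs∩S≤S xs∖S≤colours ⟩
    length S + #colours f xs                   ∎
    where
    open ≤-Reasoning
    xs∩S≤S : length (xs ∩ S) ≤ length S
    xs∩S≤S = Unique⇒length-≤ _≟_ (filter⁺ (_∈? S) !xs) (proj₂ ∘ ∈-filter⁻ (_∈? S) {xs = xs})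
    xs∖S≤colours : length (map f (xs ∖ S)) ≤ #colours f xs
    xs∖S≤colours = Unique⇒length-≤ ℕ._≟_ (map⁺-injectiveOn inj (filter⁺ (_∉? S) !xs))
                     (∈-deduplicate⁺ ℕ._≟_ {xs = map f xs} ∘ ⊆-map⁺ f (filter-⊆ (_∉? S) xs))

-- The items of G are listed as in colorsUsed; an edge is the pair (i , j) with toℕ i < toℕ j, and
-- edge i j is the item of the edge {i, j} whichever way round its endpoints are given.
Item : ℕ → Set
Item n = Fin n ⊎ (Fin n × Fin n)

_≟ₚ_ : ∀ {n} → DecidableEquality (Fin n × Fin n)
_≟ₚ_ = ×-≡-dec Fin._≟_ Fin._≟_

_≟ᵢ_ : ∀ {n} → DecidableEquality (Item n)
_≟ᵢ_ = ⊎-≡-dec Fin._≟_ _≟ₚ_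

items : ∀ {n} → Graph n → List (Item n)
items {n} G = map inj₁ (allFin n) ++ map inj₂ (edgeList G)

col : ∀ {n} → TotalColoring n → Item n → ℕ
col c (inj₁ v)       = vc c v
col c (inj₂ (i , j)) = ec c i j

sortPair : ∀ {n} → Fin n → Fin n → Fin n × Fin n
sortPair i j with toℕ i <? toℕ j
... | yes _ = i , j
... | no  _ = j , i

edge : ∀ {n} → Fin n → Fin n → Item n
edge i j = inj₂ (sortPair i j)

sortPair-< : ∀ {n} {i j : Fin n} → toℕ i < toℕ j → sortPair i j ≡ (i , j)
sortPair-< {i = i} {j} i<j with toℕ i <? toℕ j
... | yes _   = refl
... | no  i≮j = ⊥-elim (i≮j i<j)

sortPair-> : ∀ {n} {i j : Fin n} → toℕ j < toℕ i → sortPair i j ≡ (j , i)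
sortPair-> {i = i} {j} j<i with toℕ i <? toℕ j
... | yes i<j = ⊥-elim (<-asym i<j j<i)
... | no  _   = refl

sortPair-cases : ∀ {n} (i j : Fin n) → sortPair i j ≡ (i , j) ⊎ sortPair i j ≡ (j , i)
sortPair-cases i j with toℕ i <? toℕ j
... | yes _ = inj₁ refl
... | no  _ = inj₂ refl

sortPair-comm : ∀ {n} (i j : Fin n) → sortPair i j ≡ sortPair j i
sortPair-comm i j with <-cmp (toℕ i) (toℕ j)
... | tri< i<j _ _ = trans (sortPair-< i<j) (sym (sortPair-> i<j))
... | tri≈ _ i≡j _ rewrite toℕ-injective i≡j = refl
... | tri> _ _ j<i = trans (sortPair-> j<i) (sym (sortPair-< j<i))

edge-comm : ∀ {n} (i j : Fin n) → edge i j ≡ edge j i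
edge-comm i j = cong inj₂ (sortPair-comm i j)

edge-cancelʳ : ∀ {n} {x y w : Fin n} → edge x w ≡ edge y w → x ≡ y
edge-cancelʳ {x = x} {y} {w} e with sortPair x w | sortPair-cases x w | sortPair y w | sortPair-cases y w
edge-cancelʳ refl | _ | inj₁ refl | _ | inj₁ refl = refl
edge-cancelʳ refl | _ | inj₁ refl | _ | inj₂ refl = refl
edge-cancelʳ refl | _ | inj₂ refl | _ | inj₁ refl = refl
edge-cancelʳ refl | _ | inj₂ refl | _ | inj₂ refl = refl

col-edge : ∀ {n} (c : TotalColoring n) (i j : Fin n) → col c (edge i j) ≡ ec c i j
col-edge c i j with sortPair i j | sortPair-cases i j
... | _ | inj₁ refl = refl
... | _ | inj₂ refl = ec-sym c j i

module _ {n : ℕ} (G : Graph n) where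

  edge≢nonEdge : ∀ {i j} → adj G i j ≡ true → adj G i j ≢ false
  edge≢nonEdge i-j i-j′ with () ← trans (sym i-j) i-j′

  ∈-edgeList⁺ : ∀ {i j} → toℕ i < toℕ j → adj G i j ≡ true → (i , j) ∈ edgeList G
  ∈-edgeList⁺ {i} {j} i<j i-j =
    ∈-filter⁺ _ (∈-cartesianProduct⁺ (∈-allFin i) (∈-allFin j))
      (Equivalence.from T-∧ (<⇒<ᵇ i<j , Equivalence.from T-≡ i-j))

  ∈-edgeList⁻ : ∀ {i j} → (i , j) ∈ edgeList G → toℕ i < toℕ j
  ∈-edgeList⁻ {i} {j} ij∈ = <ᵇ⇒< (toℕ i) (toℕ j)
    (proj₁ (Equivalence.to T-∧ (proj₂ (∈-filter⁻ _ {xs = cartesianProduct (allFin n) (allFin n)} ij∈))))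

  vertex∈items : ∀ v → inj₁ v ∈ items G
  vertex∈items v = ∈-++⁺ˡ (∈-map⁺ inj₁ (∈-allFin v))

  edge∈items : ∀ {i j} → adj G i j ≡ true → edge i j ∈ items G
  edge∈items {i} {j} i-j with <-cmp (toℕ i) (toℕ j)
  ... | tri< i<j _ _ rewrite sortPair-< i<j = ∈-++⁺ʳ _ (∈-map⁺ inj₂ (∈-edgeList⁺ i<j i-j))
  ... | tri> _ _ j<i rewrite sortPair-> j<i =
        ∈-++⁺ʳ _ (∈-map⁺ inj₂ (∈-edgeList⁺ j<i (trans (Graph.sym G j i) i-j)))
  ... | tri≈ _ i≡j _ rewrite toℕ-injective i≡j = ⊥-elim (edge≢nonEdge i-j (irrefl G j))

  items-view : ∀ {x} → x ∈ items G → (∃ λ v → x ≡ inj₁ v) ⊎ (∃₂ λ i j → x ≡ edge i j)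
  items-view x∈ with ∈-++⁻ (map inj₁ (allFin n)) x∈
  ... | inj₁ x∈vs with ∈-map⁻ inj₁ x∈vs
  ...   | v , _ , refl = inj₁ (v , refl)
  items-view x∈ | inj₂ x∈es with ∈-map⁻ inj₂ x∈es
  ...   | (i , j) , ij∈ , refl = inj₂ (i , j , cong inj₂ (sym (sortPair-< (∈-edgeList⁻ ij∈))))

  items-unique : Unique (items G)
  items-unique =
    Unique-++⁺ (Unique-map⁺ inj₁-injective (allFin⁺ n))
               (Unique-map⁺ inj₂-injective (filter⁺ _ (cartesianProduct⁺ (allFin⁺ n) (allFin⁺ n))))
               vertices∩edges≡∅
    where
    vertices∩edges≡∅ : ∀ {x} → ¬ (x ∈ map inj₁ (allFin n) × x ∈ map inj₂ (edgeList G))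
    vertices∩edges≡∅ (x∈vs , x∈es) with ∈-map⁻ inj₁ x∈vs | ∈-map⁻ inj₂ x∈es
    ... | _ , _ , refl | _ , _ , ()

  length-items : length (items G) ≡ n + numEdges G
  length-items = trans (length-++ (map inj₁ (allFin n)))
    (cong₂ _+_ (trans (length-map inj₁ (allFin n)) (length-tabulate _)) (length-map inj₂ (edgeList G)))

  colorsUsed≡#colours : ∀ c → colorsUsed G c ≡ #colours (col c) (items G)
  colorsUsed≡#colours c = cong (length ∘ deduplicate ℕ._≟_) (sym (begin
    map (col c) (items G)
      ≡⟨ map-++ (col c) (map inj₁ (allFin n)) _ ⟩
    map (col c) (map inj₁ (allFin n)) ++ map (col c) (map inj₂ (edgeList G))
      ≡⟨ cong₂ _++_ (sym (map-∘ (allFin n))) (sym (map-∘ (edgeList G))) ⟩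
    map (vc c) (allFin n) ++ map (λ { (i , j) → ec c i j }) (edgeList G)
      ∎))
    where open ≡-Reasoning

-- Upper bounds from non-edges

freshEndpoint : ∀ {A : Set} {a b i j : A} → DecidableEquality A →
                i ≢ j → (i , j) ≢ (a , b) → (i , j) ≢ (b , a) → (i ≢ a × i ≢ b) ⊎ (j ≢ a × j ≢ b)
freshEndpoint {a = a} {b} {i} _≟_ i≢j ij≢ab ij≢ba with i ≟ a | i ≟ b
... | yes refl | _        = inj₂ ((λ { refl → i≢j refl }) , (λ { refl → ij≢ab refl }))
... | no _     | yes refl = inj₂ ((λ { refl → ij≢ba refl }) , (λ { refl → i≢j refl }))
... | no i≢a   | no i≢b   = inj₁ (i≢a , i≢b)

module _ {n : ℕ} (G : Graph n) (c : TotalColoring n) where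

  open ColourCounting (_≟ᵢ_ {n})

  colorsUsed-≤ : ∀ S cs → Unique S → All (_∈ items G) S → All (λ s → col c s ∈ cs) S →
                 length S + colorsUsed G c ≤ length cs + (n + numEdges G)
  colorsUsed-≤ S cs !S S⊆items S-colours =
    subst₂ _≤_ (cong (length S +_) (sym (colorsUsed≡#colours G c))) (cong (length cs +_) (length-items G))
      (#colours-≤ !S (All.lookup S⊆items) S-colours)

  monochromatic-≤ : ∀ S k → Unique S → All (_∈ items G) S → All (λ s → col c s ≡ k) S →
                    length S + colorsUsed G c ≤ suc (n + numEdges G)
  monochromatic-≤ S k !S S⊆items S-mono = colorsUsed-≤ S (k ∷ []) !S S⊆items (All.map here S-mono)

  ≤-colorsUsed : ∀ S →
                 (∀ {x y} → x ∈ items G → x ∉ S → y ∈ items G → y ∉ S → col c x ≡ col c y → x ≡ y) →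
                 n + numEdges G ≤ length S + colorsUsed G c
  ≤-colorsUsed S inj =
    subst₂ _≤_ (length-items G) (cong (length S +_) (sym (colorsUsed≡#colours G c)))
      (≤-#colours S (items-unique G) λ x∈ y∈ → inj′ (∈-filter⁻ _ x∈) (∈-filter⁻ _ y∈))
    where
    inj′ : ∀ {x y} → x ∈ items G × x ∉ S → y ∈ items G × y ∉ S → col c x ≡ col c y → x ≡ y
    inj′ (x∈ , x∉) (y∈ , y∉) = inj x∈ x∉ y∈ y∉

  record MonoCherry (u w y : Fin n) (k : ℕ) : Set where
    field
      u-w   : adj G u w ≡ true
      w-y   : adj G w y ≡ true
      u≢w   : u ≢ w
      w≢y   : w ≢ y
      u≢y   : u ≢ y
      ec-uw : ec c u w ≡ k
      vc-w  : vc c w ≡ k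
      ec-wy : ec c w y ≡ k

    cherryItems : List (Item n)
    cherryItems = edge u w ∷ inj₁ w ∷ edge w y ∷ []

    cherry-unique : Unique cherryItems
    cherry-unique =
      ((λ ()) ∷ (u≢y ∘ edge-cancelʳ ∘ λ e → trans e (edge-comm w y)) ∷ []) ∷ ((λ ()) ∷ []) ∷ [] ∷ []

    cherry⊆items : All (_∈ items G) cherryItems
    cherry⊆items = edge∈items G u-w ∷ vertex∈items G w ∷ edge∈items G w-y ∷ []

    cherry-monochromatic : All (λ x → col c x ≡ k) cherryItems
    cherry-monochromatic = trans (col-edge c u w) ec-uw ∷ vc-w ∷ trans (col-edge c w y) ec-wy ∷ []

    cherry-≤ : 2 + colorsUsed G c ≤ n + numEdges G
    cherry-≤ = s≤s⁻¹ (monochromatic-≤ cherryItems k cherry-unique cherry⊆items cherry-monochromatic)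

    cherry+1-≤ : ∀ z → z ∈ items G → col c z ≡ k → All (z ≢_) cherryItems →
                 3 + colorsUsed G c ≤ n + numEdges G
    cherry+1-≤ z z∈ z-colour z∉ = s≤s⁻¹ (monochromatic-≤ (z ∷ cherryItems) k
      (z∉ ∷ cherry-unique) (z∈ ∷ cherry⊆items) (z-colour ∷ cherry-monochromatic))

  open MonoCherry

  tmPath⇒cherry : ∀ {u v ws} → adj G u v ≡ false → IsTMPath G c u v ws →
                  (∃₂ λ w k → MonoCherry u w v k) ⊎
                  (∃ λ w → ∃₂ λ y k → MonoCherry u w y k × vc c y ≡ k)
  tmPath⇒cherry {ws = []} u-v ((_ , u-v′ , _) , _) = ⊥-elim (edge≢nonEdge G u-v′ u-v)
  tmPath⇒cherry {ws = w ∷ []} _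
    ((((u≢w ∷ u≢v ∷ []) ∷ (w≢v ∷ []) ∷ _) , u-w , w-v , _) , k , (vc-w ∷ []) , ec-uw , ec-wv , _) =
    inj₁ (w , k , record { u-w = u-w ; w-y = w-v ; u≢w = u≢w ; w≢y = w≢v ; u≢y = u≢v
                         ; ec-uw = ec-uw ; vc-w = vc-w ; ec-wy = ec-wv })
  tmPath⇒cherry {ws = w ∷ y ∷ _} _
    ((((u≢w ∷ u≢y ∷ _) ∷ (w≢y ∷ _) ∷ _) , u-w , w-y , _) , k , (vc-w ∷ vc-y ∷ _) , ec-uw , ec-wy , _) =
    inj₂ (w , y , k , record { u-w = u-w ; w-y = w-y ; u≢w = u≢w ; w≢y = w≢y ; u≢y = u≢y
                             ; ec-uw = ec-uw ; vc-w = vc-w ; ec-wy = ec-wy } , vc-y)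

  nonEdge-≤ : ∀ {a b} → adj G a b ≡ false → a ≢ b → IsTMCColoring G c →
              2 + colorsUsed G c ≤ n + numEdges G
  nonEdge-≤ a-b a≢b tmc with tmPath⇒cherry a-b (proj₂ (tmc _ _ a≢b))
  ... | inj₁ (_ , _ , t)         = cherry-≤ t
  ... | inj₂ (_ , _ , _ , t , _) = cherry-≤ t

  longCherry-≤ : ∀ {u w y k} → MonoCherry u w y k → vc c y ≡ k → 3 + colorsUsed G c ≤ n + numEdges G
  longCherry-≤ {y = y} t vc-y =
    cherry+1-≤ t (inj₁ y) (vertex∈items G y) vc-y
      ((λ ()) ∷ (w≢y t ∘ sym ∘ inj₁-injective) ∷ (λ ()) ∷ [])

  spoke-≤ : ∀ {a w b k} x → MonoCherry a w b k → adj G x w ≡ true → ec c x w ≡ k → x ≢ a → x ≢ b →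
            3 + colorsUsed G c ≤ n + numEdges G
  spoke-≤ {w = w} {b} x t x-w ec-xw x≢a x≢b =
    cherry+1-≤ t (edge x w) (edge∈items G x-w) (trans (col-edge c x w) ec-xw)
      ((x≢a ∘ edge-cancelʳ) ∷ (λ ()) ∷ (x≢b ∘ edge-cancelʳ ∘ λ e → trans e (edge-comm w b)) ∷ [])

  colour-separates : ∀ {S z k k′} → k ≢ k′ → All (λ x → col c x ≡ k) S → col c z ≡ k′ →
                     All (z ≢_) S
  colour-separates k≢k′ S-mono z-colour =
    All.map (λ x-colour z≡x → k≢k′ (trans (sym x-colour) (trans (cong (col c) (sym z≡x)) z-colour))) S-mono

  twoCherries-≤ : ∀ {a w₁ b k₁ i w₂ j k₂} → MonoCherry a w₁ b k₁ → MonoCherry i w₂ j k₂ →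
                  i ≢ j → (i , j) ≢ (a , b) → (i , j) ≢ (b , a) → 3 + colorsUsed G c ≤ n + numEdges G
  twoCherries-≤ {w₁ = w₁} {w₂ = w₂} t₁ t₂ i≢j ij≢ab ij≢ba with w₁ Fin.≟ w₂
  ... | yes refl with k₁≡k₂ ← trans (sym (vc-w t₁)) (vc-w t₂) | freshEndpoint Fin._≟_ i≢j ij≢ab ij≢ba
  ...   | inj₁ (i≢a , i≢b) = spoke-≤ _ t₁ (u-w t₂) (trans (ec-uw t₂) (sym k₁≡k₂)) i≢a i≢b
  ...   | inj₂ (j≢a , j≢b) = spoke-≤ _ t₁ (trans (Graph.sym G _ w₁) (w-y t₂))
                               (trans (ec-sym c _ w₁) (trans (ec-wy t₂) (sym k₁≡k₂))) j≢a j≢b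
  twoCherries-≤ {k₁ = k₁} {i} {w₂} {k₂ = k₂} t₁ t₂ _ _ _ | no w₁≢w₂ with k₁ ℕ.≟ k₂
  ... | yes refl = cherry+1-≤ t₁ (inj₁ w₂) (vertex∈items G w₂) (vc-w t₂)
                     ((λ ()) ∷ (w₁≢w₂ ∘ sym ∘ inj₁-injective) ∷ (λ ()) ∷ [])
  ... | no k₁≢k₂ = +-cancelˡ-≤ 2 _ _ (colorsUsed-≤ S (k₂ ∷ k₁ ∷ []) !S S⊆items S-colours)
    where
    S : List (Item n)
    S = edge i w₂ ∷ inj₁ w₂ ∷ cherryItems t₁
    iw₂-colour : col c (edge i w₂) ≡ k₂
    iw₂-colour = trans (col-edge c i w₂) (ec-uw t₂)
    !S : Unique S
    !S = ((λ ()) ∷ colour-separates k₁≢k₂ (cherry-monochromatic t₁) iw₂-colour)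
       ∷ colour-separates k₁≢k₂ (cherry-monochromatic t₁) (vc-w t₂)
       ∷ cherry-unique t₁
    S⊆items : All (_∈ items G) S
    S⊆items = edge∈items G (u-w t₂) ∷ vertex∈items G w₂ ∷ cherry⊆items t₁
    S-colours : All (λ x → col c x ∈ k₂ ∷ k₁ ∷ []) S
    S-colours = here iw₂-colour ∷ here (vc-w t₂) ∷ All.map (there ∘ here) (cherry-monochromatic t₁)

  twoNonEdges-≤ : ∀ {a b i j} → adj G a b ≡ false → a ≢ b → adj G i j ≡ false → i ≢ j →
                  (i , j) ≢ (a , b) → (i , j) ≢ (b , a) → IsTMCColoring G c →
                  3 + colorsUsed G c ≤ n + numEdges G
  twoNonEdges-≤ a-b a≢b i-j i≢j ij≢ab ij≢ba tmc
    with tmPath⇒cherry a-b (proj₂ (tmc _ _ a≢b)) | tmPath⇒cherry i-j (proj₂ (tmc _ _ i≢j))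
  ... | inj₂ (_ , _ , _ , t , vc-y) | _                           = longCherry-≤ t vc-y
  ... | inj₁ _                      | inj₂ (_ , _ , _ , t , vc-y) = longCherry-≤ t vc-y
  ... | inj₁ (_ , _ , t₁)           | inj₁ (_ , _ , t₂)           = twoCherries-≤ t₁ t₂ i≢j ij≢ab ij≢ba

-- Colourings attaining the bounds

adjacent⇒TMPath : ∀ {n} (G : Graph n) (c : TotalColoring n) {u v} →
                  adj G u v ≡ true → u ≢ v → IsTMPath G c u v []
adjacent⇒TMPath _ _ u-v u≢v = (((u≢v ∷ []) ∷ [] ∷ []) , u-v , tt) , _ , [] , refl , tt

cherry⇒TMPath : ∀ {n} {G : Graph n} {c u w y k} → MonoCherry G c u w y k → IsTMPath G c u y (w ∷ [])
cherry⇒TMPath t =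
  (((u≢w ∷ u≢y ∷ []) ∷ (w≢y ∷ []) ∷ [] ∷ []) , u-w , w-y , tt) , _ , (vc-w ∷ []) , ec-uw , ec-wy , tt
  where open MonoCherry t

cherry-sym : ∀ {n} {G : Graph n} {c u w y k} → MonoCherry G c u w y k → MonoCherry G c y w u k
cherry-sym {G = G} {c} {u} {w} {y} t = record
  { u-w = trans (Graph.sym G y w) w-y ; w-y = trans (Graph.sym G w u) u-w
  ; u≢w = w≢y ∘ sym ; w≢y = u≢w ∘ sym ; u≢y = u≢y ∘ sym
  ; ec-uw = trans (ec-sym c y w) ec-wy ; vc-w = vc-w ; ec-wy = trans (ec-sym c w u) ec-uw }
  where open MonoCherry t

rainbow : ∀ {n} → TotalColoring n
rainbow {n} = record
  { vc     = toℕ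
  ; ec     = λ i j → n + toℕ (uncurry combine (sortPair i j))
  ; ec-sym = λ i j → cong (λ p → n + toℕ (uncurry combine p)) (sortPair-comm i j) }

combine-pair-injective : ∀ {m} (p q : Fin m × Fin m) → uncurry combine p ≡ uncurry combine q → p ≡ q
combine-pair-injective (p₁ , p₂) (q₁ , q₂) e = ×-≡,≡→≡ (combine-injective p₁ p₂ q₁ q₂ e)

rainbow-vertex≢edge : ∀ {n} (v i j : Fin n) → col rainbow (inj₁ v) ≢ col rainbow (edge i j)
rainbow-vertex≢edge {n} v i j e =
  ≤⇒≯ (m≤m+n n _) (subst (_< n) (trans e (col-edge rainbow i j)) (toℕ<n v))

rainbow-injective : ∀ {n} (G : Graph n) {x y} → x ∈ items G → y ∈ items G →
                    col rainbow x ≡ col rainbow y → x ≡ y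
rainbow-injective {n} G x∈ y∈ with items-view G x∈ | items-view G y∈
... | inj₁ (u , refl)     | inj₁ (v , refl)       = cong inj₁ ∘ toℕ-injective
... | inj₁ (u , refl)     | inj₂ (i , j , refl)   = ⊥-elim ∘ rainbow-vertex≢edge u i j
... | inj₂ (i , j , refl) | inj₁ (v , refl)       = ⊥-elim ∘ rainbow-vertex≢edge v i j ∘ sym
... | inj₂ (i , j , refl) | inj₂ (i′ , j′ , refl) = λ e →
  cong inj₂ (combine-pair-injective _ _ (toℕ-injective (+-cancelˡ-≡ n _ _
    (trans (sym (col-edge rainbow i j)) (trans e (col-edge rainbow i′ j′))))))

≤-rainbow : ∀ {n} (G : Graph n) → n + numEdges G ≤ colorsUsed G rainbow
≤-rainbow G = ≤-colorsUsed G rainbow [] (λ x∈ _ y∈ _ → rainbow-injective G x∈ y∈)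

recolour : ∀ {n} → TotalColoring n → (w x y : Fin n) → ℕ → TotalColoring n
recolour c w x y k = record
  { vc     = λ v → if does (v Fin.≟ w) then k else vc c v
  ; ec     = λ i j → if does (edge i j ≟ᵢ edge x y) then k else ec c i j
  ; ec-sym = λ i j →
      cong₂ (λ e k′ → if does (e ≟ᵢ edge x y) then k else k′) (edge-comm i j) (ec-sym c i j) }

module _ {n} (c : TotalColoring n) (w x y : Fin n) (k : ℕ) where

  vc-recolour : vc (recolour c w x y k) w ≡ k
  vc-recolour = cong (if_then k else vc c w) (dec-true (w Fin.≟ w) refl)

  vc-recolour-≢ : ∀ {v} → v ≢ w → vc (recolour c w x y k) v ≡ vc c v
  vc-recolour-≢ {v} v≢w = cong (if_then k else vc c v) (dec-false (v Fin.≟ w) v≢w)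

  ec-recolour : ec (recolour c w x y k) x y ≡ k
  ec-recolour = cong (if_then k else ec c x y) (dec-true (edge x y ≟ᵢ edge x y) refl)

  ec-recolour-≢ : ∀ {i j} → edge i j ≢ edge x y → ec (recolour c w x y k) i j ≡ ec c i j
  ec-recolour-≢ {i} {j} ij≢xy = cong (if_then k else ec c i j) (dec-false (edge i j ≟ᵢ edge x y) ij≢xy)

  col-recolour-≢ : ∀ (G : Graph n) {z} → z ∈ items G → z ≢ inj₁ w → z ≢ edge x y →
                   col (recolour c w x y k) z ≡ col c z
  col-recolour-≢ G z∈ z≢w z≢xy with items-view G z∈
  ... | inj₁ (v , refl)     = vc-recolour-≢ (z≢w ∘ cong inj₁)
  ... | inj₂ (i , j , refl) = begin
    col (recolour c w x y k) (edge i j) ≡⟨ col-edge (recolour c w x y k) i j ⟩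
    ec (recolour c w x y k) i j         ≡⟨ ec-recolour-≢ z≢xy ⟩
    ec c i j                            ≡⟨ col-edge c i j ⟨
    col c (edge i j)                    ∎
    where open ≡-Reasoning

KnMinusK2-colouring : ∀ {n} (a w b : Fin n) → TotalColoring n
KnMinusK2-colouring a w b = recolour rainbow w w b (ec rainbow a w)

module _ {n} (G : Graph n) {a b : Fin n}
         (spec : ∀ i j → (adj G i j ≡ true → KnMinusK2 a b i j) × (KnMinusK2 a b i j → adj G i j ≡ true)) where

  KnMinusK2-nonEdge : adj G a b ≡ false
  KnMinusK2-nonEdge with adj G a b in a-b
  ... | true  = ⊥-elim (proj₁ (proj₂ (proj₁ (spec a b) a-b)) refl)
  ... | false = refl

  module _ {w : Fin n} (a≢b : a ≢ b) (a≢w : a ≢ w) (w≢b : w ≢ b) where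

    private
      k : ℕ
      k = ec rainbow a w
      C : TotalColoring n
      C = KnMinusK2-colouring a w b

    ab-cherry : MonoCherry G C a w b k
    ab-cherry = record
      { u-w = proj₂ (spec a w) (a≢w , (w≢b ∘ cong proj₂) , (a≢b ∘ cong proj₁))
      ; w-y = proj₂ (spec w b) (w≢b , (a≢w ∘ sym ∘ cong proj₁) , (w≢b ∘ cong proj₁))
      ; u≢w = a≢w ; w≢y = w≢b ; u≢y = a≢b
      ; ec-uw = ec-recolour-≢ rainbow w w b k (a≢b ∘ edge-cancelʳ ∘ λ e → trans e (edge-comm w b))
      ; vc-w = vc-recolour rainbow w w b k
      ; ec-wy = ec-recolour rainbow w w b k }

    KnMinusK2-colouring-tmc : IsTMCColoring G C
    KnMinusK2-colouring-tmc u v u≢v with adj G u v in u-v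
    ... | true = [] , adjacent⇒TMPath G C u-v u≢v
    ... | false with (u , v) ≟ₚ (a , b) | (u , v) ≟ₚ (b , a)
    ...   | yes refl | _        = w ∷ [] , cherry⇒TMPath ab-cherry
    ...   | no _     | yes refl = w ∷ [] , cherry⇒TMPath (cherry-sym ab-cherry)
    ...   | no uv≢ab | no uv≢ba = ⊥-elim (edge≢nonEdge G (proj₂ (spec u v) (u≢v , uv≢ab , uv≢ba)) u-v)

    ≤-KnMinusK2-colouring : n + numEdges G ≤ 2 + colorsUsed G C
    ≤-KnMinusK2-colouring = ≤-colorsUsed G C (inj₁ w ∷ edge w b ∷ []) λ x∈ x∉ y∈ y∉ e →
      rainbow-injective G x∈ y∈ (trans (sym (agrees x∈ x∉)) (trans e (agrees y∈ y∉)))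
      where
      agrees : ∀ {z} → z ∈ items G → z ∉ inj₁ w ∷ edge w b ∷ [] → col C z ≡ col rainbow z
      agrees z∈ z∉ = col-recolour-≢ rainbow w w b k G z∈ (z∉ ∘ here) (z∉ ∘ there ∘ here)

-- The characterisation

module _ {n : ℕ} (G : Graph n) where

  complete-or-nonEdge : (∀ u v → u ≢ v → adj G u v ≡ true) ⊎ (∃₂ λ a b → a ≢ b × adj G a b ≡ false)
  complete-or-nonEdge with any? (λ a → any? (λ b → ¬? (a Fin.≟ b) ×-dec (adj G a b Bool.≟ false)))
  ... | yes (a , b , nonEdge) = inj₂ (a , b , nonEdge)
  ... | no noNonEdge = inj₁ complete
    where
    complete : ∀ u v → u ≢ v → adj G u v ≡ true
    complete u v u≢v with adj G u v in u-v
    ... | true  = refl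
    ... | false = ⊥-elim (noNonEdge (u , v , u≢v , u-v))

  complete⇒rainbow-tmc : (∀ u v → u ≢ v → adj G u v ≡ true) → IsTMCColoring G rainbow
  complete⇒rainbow-tmc complete u v u≢v = [] , adjacent⇒TMPath G rainbow (complete u v u≢v) u≢v

  internalVertex : ∀ {a b ws} → adj G a b ≡ false → IsPath G a b ws → ∃ λ w → a ≢ w × w ≢ b
  internalVertex {ws = []} a-b (_ , a-b′ , _) = ⊥-elim (edge≢nonEdge G a-b′ a-b)
  internalVertex {ws = w ∷ ws} _ (((a≢w ∷ _) ∷ (w≢rest ∷ _)) , _) =
    w , a≢w , All.lookup w≢rest (∈-++⁺ʳ ws (here refl))

  KnMinusK2⇒tmc+2≡m+n : Connected G → ∀ {k} → TmcIs G k → IsKnMinusK2 G → 2 + k ≡ n + numEdges G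
  KnMinusK2⇒tmc+2≡m+n conn {k} ((c , c-tmc , c-colours) , maximal) (a , b , a≢b , spec)
    with internalVertex (KnMinusK2-nonEdge G spec) (proj₂ (conn a b a≢b))
  ... | w , a≢w , w≢b = ≤-antisym upper lower
    where
    upper : 2 + k ≤ n + numEdges G
    upper = subst (λ m → 2 + m ≤ n + numEdges G) c-colours
              (nonEdge-≤ G c (KnMinusK2-nonEdge G spec) a≢b c-tmc)
    lower : n + numEdges G ≤ 2 + k
    lower = ≤-trans (≤-KnMinusK2-colouring G spec a≢b a≢w w≢b)
              (+-monoʳ-≤ 2 (maximal (KnMinusK2-colouring a w b) (KnMinusK2-colouring-tmc G spec a≢b a≢w w≢b)))

  tmc+2≡m+n⇒KnMinusK2 : ∀ {k} → TmcIs G k → 2 + k ≡ n + numEdges G → IsKnMinusK2 G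
  tmc+2≡m+n⇒KnMinusK2 {k} ((c , c-tmc , c-colours) , maximal) 2+k≡N with complete-or-nonEdge
  ... | inj₁ complete = ⊥-elim (1+n≰n (≤-trans (n≤1+n _) (begin
    2 + k                 ≡⟨ 2+k≡N ⟩
    n + numEdges G        ≤⟨ ≤-rainbow G ⟩
    colorsUsed G rainbow  ≤⟨ maximal rainbow (complete⇒rainbow-tmc complete) ⟩
    k                     ∎)))
    where open ≤-Reasoning
  ... | inj₂ (a , b , a≢b , a-b) = a , b , a≢b , λ i j → edge⇒KnMinusK2 , KnMinusK2⇒edge
    where
    edge⇒KnMinusK2 : ∀ {i j} → adj G i j ≡ true → KnMinusK2 a b i j
    edge⇒KnMinusK2 {i} i-j = (λ { refl → edge≢nonEdge G i-j (irrefl G i) })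
                           , (λ { refl → edge≢nonEdge G i-j a-b })
                           , (λ { refl → edge≢nonEdge G i-j (trans (Graph.sym G b a) a-b) })
    KnMinusK2⇒edge : ∀ {i j} → KnMinusK2 a b i j → adj G i j ≡ true
    KnMinusK2⇒edge {i} {j} (i≢j , ij≢ab , ij≢ba) with adj G i j in i-j
    ... | true  = refl
    ... | false = ⊥-elim (1+n≰n (+-cancelˡ-≤ 2 _ _ (begin
      3 + k               ≡⟨ cong (3 +_) c-colours ⟨
      3 + colorsUsed G c  ≤⟨ twoNonEdges-≤ G c a-b a≢b i-j i≢j ij≢ab ij≢ba c-tmc ⟩
      n + numEdges G      ≡⟨ 2+k≡N ⟨
      2 + k               ∎)))
      where open ≤-Reasoning

theorem7 : ∀ (n : ℕ) (G : Graph n) → Connected G → ∀ (k : ℕ) → TmcIs G k →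
             ((k + 2 ≡ numEdges G + n → IsKnMinusK2 G) × (IsKnMinusK2 G → k + 2 ≡ numEdges G + n))
theorem7 n G conn k tmc =
  tmc+2≡m+n⇒KnMinusK2 G tmc ∘ swap-+ k 2 (numEdges G) n ,
  swap-+ 2 k n (numEdges G) ∘ KnMinusK2⇒tmc+2≡m+n G conn tmc
  where
  swap-+ : ∀ a b c d → a + b ≡ c + d → b + a ≡ d + c
  swap-+ a b c d e = trans (+-comm b a) (trans e (+-comm c d))
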